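{- $\omega$-Noetherian elements of divergence $\omega$-algebras may be divergent: there exist a divergence $\omega$-algebra $S$ and $a\in S$ with $a^\omega=0$ and $\nabla a\neq 0$.
   Context: An idempotent semiring is a structure $(S,+,\cdot,0,1)$ such that $(S,+,0)$ is a commutative monoid with $a+a=a$, $(S,\cdot,1)$ is a monoid, multiplication distributes over addition from both sides, and $0a=a0=0$; natural order $a\le b\iff a+b=b$. A test is an element $p\le 1$ for which some $q$ satisfies $p+q=1$ and $pq=0=qp$; $q$ is unique, written $\neg p$; tests form a Boolean algebra $\mathrm{test}(S)$. $S$ is a modal semiring if for each $a\in S$ there are maps $|a\rangle,\langle a|$ on $\mathrm{test}(S)$ with, for all $a,b,p,q$: $|a\rangle p\le q\iff \neg q\,a\,p\le 0$; $\langle a|p\le q\iff p\,a\,\neg q\le 0$; $|ab\rangle p=|a\rangle(|b\rangle p)$; $\langle ab|p=\langle b|(\langle a|p)$. A Kleene algebra is an idempotent semiring with ${}^*$ such that $1+aa^*\le a^*$, $b+ac\le c\Rightarrow a^*b\le c$, $1+a^*a\le a^*$, $b+ca\le c\Rightarrow ba^*\le c$. An $\omega$-algebra is a Kleene algebra with ${}^\omega$ such that $a^\omega\le aa^\omega$ and $c\le ac+b\Rightarrow c\le a^\omega+a^*b$. A test $\nabla a$ is the divergence of $a$ if $\nabla a\le|a\rangle\nabla a$ and for every test $p$, $p\le|a\rangle p\Rightarrow p\le\nabla a$. A divergence $\omega$-algebra is an $\omega$-algebra that is a modal semiring in which $\nabla a$ exists for all $a$. An element $a$ is $\omega$-Noetherian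 if $a^\omega\le 0$ and divergent if $\nabla a\neq 0$. -}

module Defs where

open import Level using (Level; suc; _⊔_)
open import Data.Product using (Σ; _×_; _,_; proj₁; proj₂; ∃)
open import Relation.Binary.PropositionalEquality using (_≡_)

record IdempotentSemiring (ℓ : Level) : Set (suc ℓ) where
  infixl 6 _+_
  infixl 7 _·_
  infix 4 _≤_
  field
    S    : Set ℓ
    _+_  : S → S → S
    _·_  : S → S → S
    𝟘    : S
    𝟙    : S
    +-assoc   : ∀ a b c → (a + b) + c ≡ a + (b + c)
    +-comm    : ∀ a b → a + b ≡ b + a
    +-identityˡ : ∀ a → 𝟘 + a ≡ a
    +-idem    : ∀ a → a + a ≡ a
    ·-assoc   : ∀ a b c → (a · b) · c ≡ a · (b · c)
    ·-identityˡ : ∀ a → 𝟙 · a ≡ a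
    ·-identityʳ : ∀ a → a · 𝟙 ≡ a
    distribˡ  : ∀ a b c → a · (b + c) ≡ (a · b) + (a · c)
    distribʳ  : ∀ a b c → (b + c) · a ≡ (b · a) + (c · a)
    zeroˡ     : ∀ a → 𝟘 · a ≡ 𝟘
    zeroʳ     : ∀ a → a · 𝟘 ≡ 𝟘

  _≤_ : S → S → Set ℓ
  a ≤ b = a + b ≡ b

  IsComplement : S → S → Set ℓ
  IsComplement p q = (p + q ≡ 𝟙) × (p · q ≡ 𝟘) × (q · p ≡ 𝟘)

  IsTest : S → Set ℓ
  IsTest p = (p ≤ 𝟙) × Σ S (λ q → IsComplement p q)

  Test : Set ℓ
  Test = Σ S IsTest

  neg : Test → Test
  neg (p , p≤1 , q , p+q , pq , qp) =
    q , q≤1 , p , q+p , qp , pq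
    where
      open Relation.Binary.PropositionalEquality using (trans; sym; cong)
      q+p : q + p ≡ 𝟙
      q+p = trans (+-comm q p) p+q
      -- q ≤ 1 : q + 1 = q + (p + q) = p + q = 1
      q≤1 : q + 𝟙 ≡ 𝟙
      q≤1 = trans (cong (q +_) (sym p+q))
              (trans (sym (+-assoc q p q))
                (trans (cong (_+ q) q+p)
                  (trans (cong (_+ q) (sym p+q))
                    (trans (+-assoc p q q)
                      (trans (cong (p +_) (+-idem q)) p+q)))))

record ModalSemiring (ℓ : Level) : Set (suc ℓ) where
  field
    isr : IdempotentSemiring ℓ
  open IdempotentSemiring isr public
  field
    fdia : S → Test → Test
    bdia : S → Test → Test
    fdia-galois : ∀ a (p q : Test) →
      (proj₁ (fdia a p) ≤ proj₁ q → proj₁ (neg q) · a · proj₁ p ≤ 𝟘) ×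
      (proj₁ (neg q) · a · proj₁ p ≤ 𝟘 → proj₁ (fdia a p) ≤ proj₁ q)
    bdia-galois : ∀ a (p q : Test) →
      (proj₁ (bdia a p) ≤ proj₁ q → proj₁ p · a · proj₁ (neg q) ≤ 𝟘) ×
      (proj₁ p · a · proj₁ (neg q) ≤ 𝟘 → proj₁ (bdia a p) ≤ proj₁ q)
    fdia-· : ∀ a b (p : Test) → proj₁ (fdia (a · b) p) ≡ proj₁ (fdia a (fdia b p))
    bdia-· : ∀ a b (p : Test) → proj₁ (bdia (a · b) p) ≡ proj₁ (bdia b (bdia a p))

record DivergenceOmegaAlgebra (ℓ : Level) : Set (suc ℓ) where
  field
    modal : ModalSemiring ℓ
  open ModalSemiring modal public
  field
    _⋆ : S → S
    _^ω : S → S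
    star-unfoldˡ : ∀ a → 𝟙 + a · (a ⋆) ≤ a ⋆
    star-inductˡ : ∀ a b c → b + a · c ≤ c → (a ⋆) · b ≤ c
    star-unfoldʳ : ∀ a → 𝟙 + (a ⋆) · a ≤ a ⋆
    star-inductʳ : ∀ a b c → b + c · a ≤ c → b · (a ⋆) ≤ c
    omega-unfold : ∀ a → a ^ω ≤ a · (a ^ω)
    omega-induct : ∀ a b c → c ≤ a · c + b → c ≤ (a ^ω) + (a ⋆) · b
    ∇ : S → Test
    ∇-unfold : ∀ a → proj₁ (∇ a) ≤ proj₁ (fdia a (∇ a))
    ∇-induct : ∀ a (p : Test) → proj₁ p ≤ proj₁ (fdia a p) → proj₁ p ≤ proj₁ (∇ a)

module Submission where

-- The counterexample is the tropical semiring ℕ∞ = (ℕ ∪ {∞}, min, +, ∞, 0).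
-- Its natural order is the reverse of the numeric order, so 𝟙 = 0 is the
-- greatest element and 𝟘 = ∞ the least.  Consequently:
--   * the only tests are 𝟘 and 𝟙, and the domain operator δ (δ ∞ = ∞,
--     δ n = 0) gives the modal operators |a⟩p = δ(a·p), ⟨a|p = δ(p·a);
--   * a* = 𝟙 is a Kleene star, as in any idempotent semiring whose 𝟙 is top;
--   * a^ω is 𝟙 for a = 0 and ∞ otherwise: for a = n+1 the ω-induction rule
--     holds because c ≤ a·c fails for every finite c (adding n+1 strictly
--     increases a number), and ℕ∞ is a chain, so c ≤ a·c + b forces c ≤ b;
--   * the divergence is ∇a = δa.
-- Then a = 1 is ω-Noetherian (1^ω = ∞ = 𝟘) yet divergent (∇1 = 𝟙 ≠ 𝟘).

open import Defs
open import Level using (Level; 0ℓ)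
open import Data.Product using (Σ; _×_; proj₁; _,_)
open import Data.Sum using (_⊎_; inj₁; inj₂)
open import Data.Empty using (⊥-elim)
open import Data.Nat using (ℕ; zero; suc; _⊓_; s≤s; z≤n) renaming (_+_ to _+ℕ_; _≤_ to _≤ℕ_)
import Data.Nat.Properties as ℕ
open import Relation.Binary.PropositionalEquality
  using (_≡_; refl; cong; cong₂; sym; trans; subst; module ≡-Reasoning)
open import Relation.Nullary using (¬_)

module IdempotentSemiringFacts {ℓ : Level} (R : IdempotentSemiring ℓ) where
  open IdempotentSemiring R

  +-≤-elimˡ : ∀ b x c → b + x ≤ c → b ≤ c
  +-≤-elimˡ b x c b+x≤c = begin
    b + c             ≡⟨ cong (b +_) (sym b+x≤c) ⟩
    b + ((b + x) + c) ≡⟨ sym (+-assoc b (b + x) c) ⟩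
    (b + (b + x)) + c ≡⟨ cong (_+ c) (sym (+-assoc b b x)) ⟩
    ((b + b) + x) + c ≡⟨ cong (λ y → (y + x) + c) (+-idem b) ⟩
    (b + x) + c       ≡⟨ b+x≤c ⟩
    c                 ∎
    where open ≡-Reasoning

  -- If 𝟙 is the greatest element, the constant map a ↦ 𝟙 is a Kleene star:
  -- the unfold laws hold since 𝟙 is top, the induction laws since 𝟙 is a unit.
  module OneIsTop (one-top : ∀ a → a ≤ 𝟙) where
    const-star-unfoldˡ : ∀ a → 𝟙 + a · 𝟙 ≤ 𝟙
    const-star-unfoldˡ a = one-top (𝟙 + a · 𝟙)

    const-star-unfoldʳ : ∀ a → 𝟙 + 𝟙 · a ≤ 𝟙
    const-star-unfoldʳ a = one-top (𝟙 + 𝟙 · a)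

    const-star-inductˡ : ∀ a b c → b + a · c ≤ c → 𝟙 · b ≤ c
    const-star-inductˡ a b c h =
      subst (_≤ c) (sym (·-identityˡ b)) (+-≤-elimˡ b (a · c) c h)

    const-star-inductʳ : ∀ a b c → b + c · a ≤ c → b · 𝟙 ≤ c
    const-star-inductʳ a b c h =
      subst (_≤ c) (sym (·-identityʳ b)) (+-≤-elimˡ b (c · a) c h)

data ℕ∞ : Set where
  ∞   : ℕ∞
  fin : ℕ → ℕ∞

infixl 6 _⊕_
infixl 7 _⊗_

_⊕_ : ℕ∞ → ℕ∞ → ℕ∞
∞     ⊕ y     = y
fin n ⊕ ∞     = fin n
fin n ⊕ fin m = fin (n ⊓ m)

_⊗_ : ℕ∞ → ℕ∞ → ℕ∞
∞     ⊗ y     = ∞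
fin n ⊗ ∞     = ∞
fin n ⊗ fin m = fin (n +ℕ m)

fin-injective : ∀ {n m} → fin n ≡ fin m → n ≡ m
fin-injective refl = refl

⊕-assoc : ∀ a b c → (a ⊕ b) ⊕ c ≡ a ⊕ (b ⊕ c)
⊕-assoc ∞       b       c       = refl
⊕-assoc (fin n) ∞       c       = refl
⊕-assoc (fin n) (fin m) ∞       = refl
⊕-assoc (fin n) (fin m) (fin k) = cong fin (ℕ.⊓-assoc n m k)

⊕-comm : ∀ a b → a ⊕ b ≡ b ⊕ a
⊕-comm ∞       ∞       = refl
⊕-comm ∞       (fin m) = refl
⊕-comm (fin n) ∞       = refl
⊕-comm (fin n) (fin m) = cong fin (ℕ.⊓-comm n m)

⊕-idem : ∀ a → a ⊕ a ≡ a
⊕-idem ∞       = refl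
⊕-idem (fin n) = cong fin (ℕ.⊓-idem n)

⊕-sel : ∀ a b → a ⊕ b ≡ a ⊎ a ⊕ b ≡ b
⊕-sel ∞       b       = inj₂ refl
⊕-sel (fin n) ∞       = inj₁ refl
⊕-sel (fin n) (fin m) with ℕ.⊓-sel n m
... | inj₁ n⊓m≡n = inj₁ (cong fin n⊓m≡n)
... | inj₂ n⊓m≡m = inj₂ (cong fin n⊓m≡m)

⊗-assoc : ∀ a b c → (a ⊗ b) ⊗ c ≡ a ⊗ (b ⊗ c)
⊗-assoc ∞       b       c       = refl
⊗-assoc (fin n) ∞       c       = refl
⊗-assoc (fin n) (fin m) ∞       = refl
⊗-assoc (fin n) (fin m) (fin k) = cong fin (ℕ.+-assoc n m k)

⊗-comm : ∀ a b → a ⊗ b ≡ b ⊗ a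
⊗-comm ∞       ∞       = refl
⊗-comm ∞       (fin m) = refl
⊗-comm (fin n) ∞       = refl
⊗-comm (fin n) (fin m) = cong fin (ℕ.+-comm n m)

⊗-identityˡ : ∀ a → fin 0 ⊗ a ≡ a
⊗-identityˡ ∞       = refl
⊗-identityˡ (fin n) = refl

⊗-identityʳ : ∀ a → a ⊗ fin 0 ≡ a
⊗-identityʳ a = trans (⊗-comm a (fin 0)) (⊗-identityˡ a)

⊗-distribˡ : ∀ a b c → a ⊗ (b ⊕ c) ≡ a ⊗ b ⊕ a ⊗ c
⊗-distribˡ ∞       b       c       = refl
⊗-distribˡ (fin n) ∞       c       = refl
⊗-distribˡ (fin n) (fin m) ∞       = refl
⊗-distribˡ (fin n) (fin m) (fin k) = cong fin (ℕ.+-distribˡ-⊓ n m k)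

⊗-distribʳ : ∀ a b c → (b ⊕ c) ⊗ a ≡ b ⊗ a ⊕ c ⊗ a
⊗-distribʳ a b c = begin
  (b ⊕ c) ⊗ a     ≡⟨ ⊗-comm (b ⊕ c) a ⟩
  a ⊗ (b ⊕ c)     ≡⟨ ⊗-distribˡ a b c ⟩
  a ⊗ b ⊕ a ⊗ c   ≡⟨ cong₂ _⊕_ (⊗-comm a b) (⊗-comm a c) ⟩
  b ⊗ a ⊕ c ⊗ a   ∎
  where open ≡-Reasoning

⊗-zeroʳ : ∀ a → a ⊗ ∞ ≡ ∞
⊗-zeroʳ a = ⊗-comm a ∞

tropical : IdempotentSemiring 0ℓ
tropical = record
  { S = ℕ∞ ; _+_ = _⊕_ ; _·_ = _⊗_ ; 𝟘 = ∞ ; 𝟙 = fin 0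
  ; +-assoc = ⊕-assoc ; +-comm = ⊕-comm ; +-identityˡ = λ _ → refl
  ; +-idem = ⊕-idem ; ·-assoc = ⊗-assoc
  ; ·-identityˡ = ⊗-identityˡ ; ·-identityʳ = ⊗-identityʳ
  ; distribˡ = ⊗-distribˡ ; distribʳ = ⊗-distribʳ
  ; zeroˡ = λ _ → refl ; zeroʳ = ⊗-zeroʳ }

open IdempotentSemiring tropical using (_≤_; Test; IsTest; neg)
open IdempotentSemiringFacts tropical using (module OneIsTop)

≤-one : ∀ a → a ≤ fin 0
≤-one ∞       = refl
≤-one (fin n) = cong fin (ℕ.⊓-zeroʳ n)

one-absorbs : ∀ a → fin 0 ⊕ a ≡ fin 0
one-absorbs a = trans (⊕-comm (fin 0) a) (≤-one a)

fin-≤⇒≥ : ∀ {k m} → fin k ≤ fin m → m ≤ℕ k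
fin-≤⇒≥ {k} {m} k⊓m≡m = subst (_≤ℕ k) (fin-injective k⊓m≡m) (ℕ.m⊓n≤m k m)

¬≤-shift : ∀ n k → ¬ (fin k ≤ fin (suc n) ⊗ fin k)
¬≤-shift n k h = ℕ.<-irrefl refl (ℕ.<-≤-trans (ℕ.m<n+m k (s≤s z≤n)) (fin-≤⇒≥ h))

δ : ℕ∞ → ℕ∞
δ ∞       = ∞
δ (fin _) = fin 0

δ-test : ∀ a → IsTest (δ a)
δ-test ∞       = refl , fin 0 , refl , refl , refl
δ-test (fin _) = refl , ∞ , refl , refl , refl

dom : ℕ∞ → Test
dom a = δ a , δ-test a

-- Galois property of the domain: δx ≤ q iff ¬q·x ≤ 𝟘.  A test is 𝟘 or 𝟙,
-- and the complement equations force the shape of each.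
δ-galois : ∀ x (q : Test) →
  (δ x ≤ proj₁ q → proj₁ (neg q) ⊗ x ≤ ∞) × (proj₁ (neg q) ⊗ x ≤ ∞ → δ x ≤ proj₁ q)
δ-galois x       (∞ , _ , ∞ , () , _)
δ-galois ∞       (∞ , _ , fin .0 , refl , _) = (λ _ → refl) , (λ _ → refl)
δ-galois (fin n) (∞ , _ , fin .0 , refl , _) = (λ ()) , (λ ())
δ-galois x       (fin .0 , _ , ∞ , refl , _) = (λ _ → refl) , (λ _ → ≤-one (δ x))
δ-galois x       (fin n , _ , fin m , _ , () , _)

δ-local : ∀ a u → δ (a ⊗ u) ≡ δ (a ⊗ δ u)
δ-local ∞       u       = refl
δ-local (fin n) ∞       = refl
δ-local (fin n) (fin m) = refl

tropical-modal : ModalSemiring 0ℓ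
tropical-modal = record
  { isr = tropical
  ; fdia = λ a p → dom (a ⊗ proj₁ p)
  ; bdia = λ a p → dom (proj₁ p ⊗ a)
  ; fdia-galois = λ a p q →
      subst (λ y → (δ (a ⊗ proj₁ p) ≤ proj₁ q → y ≤ ∞) × (y ≤ ∞ → δ (a ⊗ proj₁ p) ≤ proj₁ q))
            (sym (⊗-assoc (proj₁ (neg q)) a (proj₁ p)))
            (δ-galois (a ⊗ proj₁ p) q)
  ; bdia-galois = λ a p q →
      subst (λ y → (δ (proj₁ p ⊗ a) ≤ proj₁ q → y ≤ ∞) × (y ≤ ∞ → δ (proj₁ p ⊗ a) ≤ proj₁ q))
            (⊗-comm (proj₁ (neg q)) (proj₁ p ⊗ a))
            (δ-galois (proj₁ p ⊗ a) q)
  ; fdia-· = fdia-·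
  ; bdia-· = bdia-·
  }
  where
    open ≡-Reasoning

    fdia-· : ∀ a b (p : Test) → δ ((a ⊗ b) ⊗ proj₁ p) ≡ δ (a ⊗ δ (b ⊗ proj₁ p))
    fdia-· a b (p , _) = begin
      δ ((a ⊗ b) ⊗ p)   ≡⟨ cong δ (⊗-assoc a b p) ⟩
      δ (a ⊗ (b ⊗ p))   ≡⟨ δ-local a (b ⊗ p) ⟩
      δ (a ⊗ δ (b ⊗ p)) ∎

    bdia-· : ∀ a b (p : Test) → δ (proj₁ p ⊗ (a ⊗ b)) ≡ δ (δ (proj₁ p ⊗ a) ⊗ b)
    bdia-· a b (p , _) = begin
      δ (p ⊗ (a ⊗ b))   ≡⟨ cong δ (trans (sym (⊗-assoc p a b)) (⊗-comm (p ⊗ a) b)) ⟩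
      δ (b ⊗ (p ⊗ a))   ≡⟨ δ-local b (p ⊗ a) ⟩
      δ (b ⊗ δ (p ⊗ a)) ≡⟨ cong δ (⊗-comm b (δ (p ⊗ a))) ⟩
      δ (δ (p ⊗ a) ⊗ b) ∎

ω-iterate : ℕ∞ → ℕ∞
ω-iterate ∞             = ∞
ω-iterate (fin zero)    = fin 0
ω-iterate (fin (suc _)) = ∞

ω-unfold : ∀ a → ω-iterate a ≤ a ⊗ ω-iterate a
ω-unfold ∞             = refl
ω-unfold (fin zero)    = refl
ω-unfold (fin (suc _)) = refl

-- For a = n+1 the ω-induction rule reduces to  c ≤ a·c + b ⇒ c ≤ b:
-- the sum a·c + b is a·c or b, and c ≤ a·c is impossible unless c = ∞.
ω-induct-shift : ∀ n b c → c ≤ fin (suc n) ⊗ c ⊕ b → c ≤ b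
ω-induct-shift n b ∞       _ = refl
ω-induct-shift n b (fin k) h with ⊕-sel (fin (suc n) ⊗ fin k) b
... | inj₁ sum≡ac = ⊥-elim (¬≤-shift n k (subst (fin k ≤_) sum≡ac h))
... | inj₂ sum≡b  = subst (fin k ≤_) sum≡b h

ω-induct : ∀ a b c → c ≤ a ⊗ c ⊕ b → c ≤ ω-iterate a ⊕ fin 0 ⊗ b
ω-induct ∞             b c h = subst (c ≤_) (sym (⊗-identityˡ b)) h
ω-induct (fin zero)    b c _ = subst (c ≤_) (sym (one-absorbs (fin 0 ⊗ b))) (≤-one c)
ω-induct (fin (suc n)) b c h = subst (c ≤_) (sym (⊗-identityˡ b)) (ω-induct-shift n b c h)

tropical-divergence : DivergenceOmegaAlgebra 0ℓ
tropical-divergence = record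
  { modal = tropical-modal
  ; _⋆ = λ _ → fin 0
  ; _^ω = ω-iterate
  ; star-unfoldˡ = const-star-unfoldˡ
  ; star-inductˡ = const-star-inductˡ
  ; star-unfoldʳ = const-star-unfoldʳ
  ; star-inductʳ = const-star-inductʳ
  ; omega-unfold = ω-unfold
  ; omega-induct = ω-induct
  ; ∇ = dom
  ; ∇-unfold = ∇-unfold
  ; ∇-induct = ∇-induct
  }
  where
    open OneIsTop ≤-one

    ∇-unfold : ∀ a → δ a ≤ δ (a ⊗ δ a)
    ∇-unfold ∞       = refl
    ∇-unfold (fin _) = refl

    -- For a = ∞ the hypothesis already says p ≤ 𝟘; otherwise ∇a = 𝟙 is top.
    ∇-induct : ∀ a (p : Test) → proj₁ p ≤ δ (a ⊗ proj₁ p) → proj₁ p ≤ δ a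
    ∇-induct ∞       p h = h
    ∇-induct (fin _) p _ = ≤-one (proj₁ p)

corollary7p6 : Σ (DivergenceOmegaAlgebra 0ℓ) (λ D → let open DivergenceOmegaAlgebra D in
    Σ S (λ a → ((a ^ω) ≡ 𝟘) × ¬ (proj₁ (∇ a) ≡ 𝟘)))
corollary7p6 = tropical-divergence , fin 1 , refl , (λ ())
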